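{- Let $G$ be a complete signed graph on vertex set $V$, let $u\neq v$ be vertices, and let $H$ be the complete signed graph obtained from $G$ by flipping the sign of the pair $\{u,v\}$ (either from $-$ to $+$ or from $+$ to $-$). Let $S=N_{G^+}(u)\cup N_{G^+}(v)\cup\{u,v\}$. Then: \begin{enumerate} \item For all vertices $w\notin S$, if $w$ is $\varepsilon$-light in $G^+$, then $w$ is $\varepsilon$-light in $H^+$. \item For all vertices $w\notin S$, if $w$ is not $\varepsilon$-light in $G^+$, then $w$ is not $\varepsilon$-light in $H^+$. \end{enumerate}
   Context: A complete signed graph on a finite vertex set $V$ assigns to every unordered pair of distinct vertices a sign $+$ or $-$. For such a graph $X$, its positive graph $X^+=(V,E^+)$ has as edges the pairs of sign $+$; $N_{X^+}(a)$ is the open neighborhood of $a$ in $X^+$. Fix $\varepsilon>0$. $\mathrm{NonAgreement}_{X^+}(a,b)=\frac{|N_{X^+}(a)\,\Delta\,N_{X^+}(b)|}{\max\{|N_{X^+}(a)|,|N_{X^+}(b)|\}}$ ($\Delta$ = symmetric difference). Vertices $a,b$ are in $\varepsilon$-agreement in $X^+$ if $\{a,b\}$ is an edge of $X^+$ and $\mathrm{NonAgreement}_{X^+}(a,b)<\varepsilon$. $\mathrm{AgreeCnt}_{X^+}(a)$ is the number of vertices in $\varepsilon$-agreement with $a$ in $X^+$, and $a$ is $\varepsilon$-light in $X^+$ if $\mathrm{AgreeCnt}_{X^+}(a)/|N_{X^+}(a)|<\varepsilon$.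
   Formalization: The parameter ε ranges over the positive rationals rather than the positive reals. -}

module Defs where

open import Data.Nat using (ℕ; _⊔_)
open import Data.Bool using (Bool; true; false; not; _∧_; _∨_; _xor_; if_then_else_)
open import Data.Fin using (Fin; _≟_)
open import Data.List using (List; filter; length)
open import Data.Fin.Base using () 
open import Data.List using () renaming (map to lmap)
open import Data.Fin.Properties using ()
open import Data.Vec.Functional using ()
open import Data.Integer using (+_)
open import Data.Rational using (ℚ; _<_; _*_; Positive) renaming (_/_ to _÷_)
open import Relation.Nullary using (¬_; Dec; yes; no; does)
open import Relation.Nullary.Decidable using (⌊_⌋; _×-dec_)
open import Relation.Binary.PropositionalEquality using (_≡_; _≢_)
import Data.List as L
open import Data.Product using (_×_; _,_; proj₁; proj₂)
open import Data.Sum using (_⊎_)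
open import Relation.Binary.PropositionalEquality using (refl)

-- A complete signed graph on vertex set Fin n: a sign for every pair of vertices
-- (true = +, false = -), symmetric.  Values on the diagonal are irrelevant:
-- all notions below only look at pairs of distinct vertices.
record SignedGraph (n : ℕ) : Set where
  field
    sign : Fin n → Fin n → Bool
    sym  : ∀ a b → sign a b ≡ sign b a
open SignedGraph public

vertices : (n : ℕ) → List (Fin n)
vertices n = L.allFin n

adj : ∀ {n} → SignedGraph n → Fin n → Fin n → Bool
adj X a b = if ⌊ a ≟ b ⌋ then false else sign X a b

countV : ∀ {n} → (Fin n → Bool) → ℕ
countV {n} p = length (filter (λ x → p x Data.Bool.≟ true) (vertices n))

deg : ∀ {n} → SignedGraph n → Fin n → ℕ
deg X a = countV (λ x → adj X a x)

symDiff : ∀ {n} → SignedGraph n → Fin n → Fin n → ℕ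
symDiff X a b = countV (λ x → adj X a x xor adj X b x)

toℚ : ℕ → ℚ
toℚ k = (+ k) ÷ 1

-- Since {a,b} ∈ E⁺ the
-- denominator max{|N(a)|,|N(b)|} is positive, so NonAgreement < ε is stated
-- equivalently (cleared of the positive denominator) as |N(a) Δ N(b)| < ε·max.
InAgreement : ∀ {n} → ℚ → SignedGraph n → Fin n → Fin n → Set
InAgreement ε X a b = adj X a b ≡ true × (toℚ (symDiff X a b) < ε * toℚ (deg X a ⊔ deg X b))

inAgreement? : ∀ {n} (ε : ℚ) (X : SignedGraph n) a b → Dec (InAgreement ε X a b)
inAgreement? ε X a b = (adj X a b Data.Bool.≟ true) ×-dec (toℚ (symDiff X a b) Data.Rational.<? ε * toℚ (deg X a ⊔ deg X b))

agreeCnt : ∀ {n} → ℚ → SignedGraph n → Fin n → ℕ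
agreeCnt ε X a = countV (λ b → ⌊ inAgreement? ε X a b ⌋)

-- a is ε-light in X⁺ : AgreeCnt(a) / |N(a)| < ε, stated as AgreeCnt(a) < ε·|N(a)|
-- (equivalent when |N(a)| > 0; for an isolated vertex this makes it not light).
Light : ∀ {n} → ℚ → SignedGraph n → Fin n → Set
Light ε X a = toℚ (agreeCnt ε X a) < ε * toℚ (deg X a)

flipPair : ∀ {n} → SignedGraph n → Fin n → Fin n → SignedGraph n
flipPair {n} X u v = record { sign = s ; sym = s-sym }
  where
  isUV : Fin n → Fin n → Bool
  isUV a b = (⌊ a ≟ u ⌋ ∧ ⌊ b ≟ v ⌋) ∨ (⌊ a ≟ v ⌋ ∧ ⌊ b ≟ u ⌋)
  s : Fin n → Fin n → Bool
  s a b = if isUV a b then not (sign X a b) else sign X a b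
  isUV-sym : ∀ a b → isUV a b ≡ isUV b a
  isUV-sym a b = ∨-comm (⌊ a ≟ u ⌋ ∧ ⌊ b ≟ v ⌋) (⌊ a ≟ v ⌋ ∧ ⌊ b ≟ u ⌋) ■ cong₂ _∨_ (∧-comm ⌊ a ≟ v ⌋ ⌊ b ≟ u ⌋) (∧-comm ⌊ a ≟ u ⌋ ⌊ b ≟ v ⌋)
    where open import Data.Bool.Properties using (∨-comm; ∧-comm)
          open import Relation.Binary.PropositionalEquality using (cong₂) renaming (trans to _■_)
  s-sym : ∀ a b → s a b ≡ s b a
  s-sym a b rewrite isUV-sym a b | SignedGraph.sym X a b = refl

InS : ∀ {n} → SignedGraph n → Fin n → Fin n → Fin n → Set
InS G u v w = (adj G u w ≡ true) ⊎ (adj G v w ≡ true) ⊎ (w ≡ u) ⊎ (w ≡ v)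

{-# OPTIONS --safe #-}
module Submission where

open import Defs hiding (sym)
open import Data.Nat using (ℕ; _⊔_)
open import Data.Bool using (Bool; true; _xor_)
import Data.Bool as Bool
open import Data.Empty using (⊥-elim)
open import Data.Fin using (Fin; _≟_)
open import Data.List using (length)
open import Data.List.Properties using (filter-≐)
open import Data.Product using (_×_; _,_)
open import Data.Sum using (inj₁; inj₂)
open import Data.Rational using (ℚ; Positive; _<_; _*_)
open import Function.Bundles using (_⇔_; mk⇔; module Equivalence)
open import Relation.Nullary using (¬_; yes; no)
open import Relation.Nullary.Decidable using (Dec; ⌊_⌋; does-⇔; isYes≗does)
open import Relation.Binary.PropositionalEquality
  using (_≡_; _≢_; refl; sym; trans; cong; cong₂)

-- Whether w is light depends only on the positive rows of w and of its positive neighbours: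
-- every agreement partner of w is a neighbour of w, and the counts involved read only those
-- rows.  Flipping {u, v} changes only the rows of u and v, and for w ∉ S neither w nor any
-- neighbour of w is u or v.

countV-cong : ∀ {n} {p q : Fin n → Bool} → (∀ x → p x ≡ q x) → countV p ≡ countV q
countV-cong {n} {p} {q} p≗q =
  cong length (filter-≐ (λ x → p x Bool.≟ true) (λ x → q x Bool.≟ true)
                        ((λ {x} px → trans (sym (p≗q x)) px) , (λ {x} qx → trans (p≗q x) qx))
                        (vertices n))

isYes-⇔ : ∀ {A B : Set} → A ⇔ B → (a? : Dec A) (b? : Dec B) → ⌊ a? ⌋ ≡ ⌊ b? ⌋
isYes-⇔ A⇔B a? b? = trans (isYes≗does a?) (trans (does-⇔ A⇔B a? b?) (sym (isYes≗does b?)))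

SameRow : ∀ {n} → SignedGraph n → SignedGraph n → Fin n → Set
SameRow H G a = ∀ x → adj H a x ≡ adj G a x

adj-sym : ∀ {n} (G : SignedGraph n) a b → adj G a b ≡ adj G b a
adj-sym G a b with a ≟ b | b ≟ a
... | yes _   | yes _   = refl
... | no _    | no _    = SignedGraph.sym G a b
... | yes a≡b | no b≢a  = ⊥-elim (b≢a (sym a≡b))
... | no a≢b  | yes b≡a = ⊥-elim (a≢b (sym b≡a))

adj-flipPair : ∀ {n} (G : SignedGraph n) u v a b → a ≢ u → a ≢ v →
               adj (flipPair G u v) a b ≡ adj G a b
adj-flipPair G u v a b a≢u a≢v with a ≟ b
... | yes _ = refl
... | no _ with a ≟ u | a ≟ v
...   | yes a≡u | _       = ⊥-elim (a≢u a≡u)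
...   | no _    | yes a≡v = ⊥-elim (a≢v a≡v)
...   | no _    | no _    = refl

ratio-cong : ∀ ε {s s′ d d′ : ℕ} → s ≡ s′ → d ≡ d′ → toℚ s < ε * toℚ d → toℚ s′ < ε * toℚ d′
ratio-cong ε refl refl lt = lt

module _ {n} (H G : SignedGraph n) where

  deg-cong : ∀ a → SameRow H G a → deg H a ≡ deg G a
  deg-cong a row = countV-cong row

  symDiff-cong : ∀ a b → SameRow H G a → SameRow H G b →
                 symDiff H a b ≡ symDiff G a b
  symDiff-cong a b rowa rowb = countV-cong (λ x → cong₂ _xor_ (rowa x) (rowb x))

  inAgreement-cong : ∀ ε a b → SameRow H G a → SameRow H G b →
                     InAgreement ε H a b ⇔ InAgreement ε G a b
  inAgreement-cong ε a b rowa rowb = mk⇔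
    (λ (ab , lt) → trans (sym (rowa b)) ab , ratio-cong ε symDiff≡ deg⊔deg≡ lt)
    (λ (ab , lt) → trans (rowa b) ab , ratio-cong ε (sym symDiff≡) (sym deg⊔deg≡) lt)
    where
    symDiff≡ : symDiff H a b ≡ symDiff G a b
    symDiff≡ = symDiff-cong a b rowa rowb
    deg⊔deg≡ : deg H a ⊔ deg H b ≡ deg G a ⊔ deg G b
    deg⊔deg≡ = cong₂ _⊔_ (deg-cong a rowa) (deg-cong b rowb)

  module _ (ε : ℚ) (w : Fin n) (row-w : SameRow H G w)
           (row-nbr : ∀ b → adj G w b ≡ true → SameRow H G b) where

    inAgreement-local : ∀ b → InAgreement ε H w b ⇔ InAgreement ε G w b
    inAgreement-local b = mk⇔ to from
      where
      to : InAgreement ε H w b → InAgreement ε G w b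
      to ag@(wb , _) =
        Equivalence.to (inAgreement-cong ε w b row-w (row-nbr b (trans (sym (row-w b)) wb))) ag
      from : InAgreement ε G w b → InAgreement ε H w b
      from ag@(wb , _) = Equivalence.from (inAgreement-cong ε w b row-w (row-nbr b wb)) ag

    agreeCnt-local : agreeCnt ε H w ≡ agreeCnt ε G w
    agreeCnt-local = countV-cong λ b →
      isYes-⇔ (inAgreement-local b) (inAgreement? ε H w b) (inAgreement? ε G w b)

    Light-local : Light ε H w ⇔ Light ε G w
    Light-local = mk⇔ (ratio-cong ε agreeCnt-local (deg-cong w row-w))
                      (ratio-cong ε (sym agreeCnt-local) (sym (deg-cong w row-w)))

Light-flipPair : ∀ {n} ε (G : SignedGraph n) u v w → ¬ InS G u v w →
                 Light ε (flipPair G u v) w ⇔ Light ε G w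
Light-flipPair ε G u v w w∉S =
  Light-local (flipPair G u v) G ε w (away w w≢u w≢v) λ b wb → away b (b≢u wb) (b≢v wb)
  where
  away : ∀ a → a ≢ u → a ≢ v → SameRow (flipPair G u v) G a
  away a a≢u a≢v x = adj-flipPair G u v a x a≢u a≢v
  w≢u : w ≢ u
  w≢u w≡u = w∉S (inj₂ (inj₂ (inj₁ w≡u)))
  w≢v : w ≢ v
  w≢v w≡v = w∉S (inj₂ (inj₂ (inj₂ w≡v)))
  b≢u : ∀ {b} → adj G w b ≡ true → b ≢ u
  b≢u wb refl = w∉S (inj₁ (trans (adj-sym G u w) wb))
  b≢v : ∀ {b} → adj G w b ≡ true → b ≢ v
  b≢v wb refl = w∉S (inj₂ (inj₁ (trans (adj-sym G v w) wb)))

theorem4 : ∀ {n : ℕ} (ε : ℚ) → Positive ε → (G : SignedGraph n) (u v : Fin n) → u ≢ v →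
    ((w : Fin n) → ¬ InS G u v w → Light ε G w → Light ε (flipPair G u v) w)
    × ((w : Fin n) → ¬ InS G u v w → ¬ Light ε G w → ¬ Light ε (flipPair G u v) w)
theorem4 ε _ G u v _ =
    (λ w w∉S → Equivalence.from (Light-flipPair ε G u v w w∉S))
  , (λ w w∉S ¬light light → ¬light (Equivalence.to (Light-flipPair ε G u v w w∉S) light))
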